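{- Let $k\in\mathbb{N}$ and $S=\langle 6k+7,6k+11,6k+13\rangle$. Then \[\mathrm{Ap}(S,6k+7)=\{a(6k+11)+b(6k+13)\mid (a,b)\in C\},\] where $C=\big(\{0,1,2\}\times\{0,1,\dots,2k+2\}\big)\setminus\{(2,2k+1),(2,2k+2)\}$.
   Context: $\mathbb{N}=\{0,1,2,\dots\}$. For $X\subseteq\mathbb{N}$, $\langle X\rangle$ is the submonoid of $(\mathbb{N},+)$ generated by $X$; here it is a numerical semigroup. For a numerical semigroup $S$ and $n\in S\setminus\{0\}$, the Apéry set is $\mathrm{Ap}(S,n)=\{s\in S\mid s-n\notin S\}$. -}

module Defs where

open import Data.Nat using (ℕ; zero; suc; _+_; _*_; _≤_; _<_; _∸_)
open import Data.List using (List)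
open import Data.List.Membership.Propositional using (_∈_)
open import Data.Product using (Σ; _×_; ∃; _,_)
open import Data.Sum using (_⊎_)
open import Relation.Nullary using (¬_)
open import Relation.Binary.PropositionalEquality using (_≡_)

data ⟨_⟩ (X : List ℕ) : ℕ → Set where
  zero∈ : ⟨ X ⟩ 0
  gen+  : ∀ {g s} → g ∈ X → ⟨ X ⟩ s → ⟨ X ⟩ (g + s)

-- Apéry set membership: s ∈ Ap(S,n) iff s ∈ S and s - n ∉ S
-- (s - n is an integer; when s < n it is negative and hence not in S ⊆ ℕ).
Ap : (ℕ → Set) → ℕ → ℕ → Set
Ap S n s = S s × ((n≤s : n ≤ s) → ¬ S (s ∸ n))

C : ℕ → ℕ → ℕ → Set
C k a b = (a ≤ 2 × b ≤ 2 * k + 2) × ¬ (a ≡ 2 × b ≡ 2 * k + 1) × ¬ (a ≡ 2 × b ≡ 2 * k + 2)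

{-# OPTIONS --safe #-}
module Submission where

-- Write n = 6k+7, p = n+4, q = n+6, so that x·n + y·p + z·q = (x+y+z)·n + 2(2y+3z):
-- a count of generators times n plus twice a weight.  The relations 3p = n + 2q,
-- (2k+3)q = (2k+4)n + p, 2p + (2k+1)q = (2k+5)n and 2p + (2k+2)q = (2k+5)n + q
-- show that a representation x·n + a·p + b·q of an Apéry element has x = 0 and
-- (a,b) ∈ C.  Conversely let a·p + b·q = n + x·n + y·p + z·q with (a,b) ∈ C.
-- If the right side uses no more generators than the left, then 3·count − weight,
-- which is a on the left and 3 + 3x + y on the right, can only grow from right to
-- left, so a ≥ 3.  If it uses exactly one more, the weights differ by n/2, but n is
-- odd.  If it uses at least two more, 2a + 3b ≥ n, which within C forces
-- (a,b) = (1,2k+2), and then 2 = e·n + 2(2y+3z) for some e, which is impossible.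

open import Defs
open import Data.Nat using (ℕ; zero; suc; _+_; _*_; _≤_; _≤?_; z≤n; s≤s)
open import Data.Nat.Properties
open import Data.Nat.Tactic.RingSolver using (solve-∀; solve)
open import Data.List using (_∷_; [])
open import Data.List.Membership.Propositional using (_∈_)
open import Data.List.Relation.Unary.Any using (here; there)
open import Data.Product using (∃; _×_; _,_; proj₁)
open import Data.Empty using (⊥-elim)
open import Relation.Nullary using (¬_; yes; no)
open import Function.Bundles using (_⇔_; mk⇔)
open import Relation.Binary.PropositionalEquality

⟨⟩-+ : ∀ {X s t} → ⟨ X ⟩ s → ⟨ X ⟩ t → ⟨ X ⟩ (s + t)
⟨⟩-+ zero∈ t∈ = t∈
⟨⟩-+ {X} {t = t} (gen+ {g} {s} g∈X s∈) t∈ =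
  subst ⟨ X ⟩ (sym (+-assoc g s t)) (gen+ g∈X (⟨⟩-+ s∈ t∈))

⟨⟩-multiple : ∀ {X g} → g ∈ X → ∀ m → ⟨ X ⟩ (m * g)
⟨⟩-multiple g∈X zero    = zero∈
⟨⟩-multiple g∈X (suc m) = gen+ g∈X (⟨⟩-multiple g∈X m)

combination∈⟨⟩₃ : ∀ {g₁ g₂ g₃} x a b → ⟨ g₁ ∷ g₂ ∷ g₃ ∷ [] ⟩ (x * g₁ + a * g₂ + b * g₃)
combination∈⟨⟩₃ x a b =
  ⟨⟩-+ (⟨⟩-+ (⟨⟩-multiple (here refl) x) (⟨⟩-multiple (there (here refl)) a))
       (⟨⟩-multiple (there (there (here refl))) b)

⟨⟩₃⇒combination : ∀ {g₁ g₂ g₃ s} → ⟨ g₁ ∷ g₂ ∷ g₃ ∷ [] ⟩ s →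
                  ∃ λ x → ∃ λ a → ∃ λ b → s ≡ x * g₁ + a * g₂ + b * g₃
⟨⟩₃⇒combination zero∈ = 0 , 0 , 0 , refl
⟨⟩₃⇒combination {g₁} {g₂} {g₃} (gen+ (here refl) s∈) with ⟨⟩₃⇒combination s∈
... | x , a , b , refl = suc x , a , b , solve (g₁ ∷ g₂ ∷ g₃ ∷ x ∷ a ∷ b ∷ [])
⟨⟩₃⇒combination {g₁} {g₂} {g₃} (gen+ (there (here refl)) s∈) with ⟨⟩₃⇒combination s∈
... | x , a , b , refl = x , suc a , b , solve (g₁ ∷ g₂ ∷ g₃ ∷ x ∷ a ∷ b ∷ [])
⟨⟩₃⇒combination {g₁} {g₂} {g₃} (gen+ (there (there (here refl))) s∈) with ⟨⟩₃⇒combination s∈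
... | x , a , b , refl = x , a , suc b , solve (g₁ ∷ g₂ ∷ g₃ ∷ x ∷ a ∷ b ∷ [])

Ap-¬shift : ∀ (S : ℕ → Set) {n s t} → Ap S n s → S t → s ≢ n + t
Ap-¬shift S {n} {t = t} (_ , s∸n∉S) t∈S refl =
  s∸n∉S (m≤m+n n t) (subst S (sym (m+n∸m≡n n t)) t∈S)

shift-free⇒Ap : ∀ {S : ℕ → Set} {n s} → S s → (∀ {t} → S t → s ≢ n + t) → Ap S n s
shift-free⇒Ap s∈S shift-free = s∈S , λ n≤s s∸n∈S → shift-free s∸n∈S (sym (m+[n∸m]≡n n≤s))

cancel-multiples : ∀ n {u v d r r′} → u + d ≡ v → u * n + r ≡ v * n + r′ → r ≡ d * n + r′
cancel-multiples n {u} {d = d} {r} {r′} refl eq =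
  +-cancelˡ-≡ (u * n) r (d * n + r′) (trans eq (solve (u ∷ d ∷ n ∷ r′ ∷ [])))

count≥⇒3≤a : ∀ n a b x y z →
  (a + b) * n + 2 * (2 * a + 3 * b) ≡ (1 + x + y + z) * n + 2 * (2 * y + 3 * z) →
  1 + x + y + z ≤ a + b → 3 ≤ a
count≥⇒3≤a n a b x y z eq more with m≤n⇒∃[o]m+o≡n more
... | m , more-by-m = *-cancelˡ-≤ 2 (begin
  2 * 3                                 ≤⟨ *-monoʳ-≤ 2 (m≤m+n 3 (3 * x + y)) ⟩
  2 * (3 + (3 * x + y))                 ≤⟨ m≤m+n _ (m * (n + 6)) ⟩
  2 * (3 + (3 * x + y)) + m * (n + 6)   ≡⟨ twice-a ⟨
  2 * a                                 ∎)
  where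
  open ≤-Reasoning
  residue : 2 * (2 * y + 3 * z) ≡ m * n + 2 * (2 * a + 3 * b)
  residue = cancel-multiples n {u = 1 + x + y + z} more-by-m (sym eq)
  twice-a : 2 * a ≡ 2 * (3 + (3 * x + y)) + m * (n + 6)
  twice-a = +-cancelʳ-≡ (2 * (2 * a + 3 * b)) (2 * a) _ (begin-equality
    2 * a + 2 * (2 * a + 3 * b)                      ≡⟨ solve (a ∷ b ∷ []) ⟩
    6 * (a + b)                                      ≡⟨ cong (6 *_) more-by-m ⟨
    6 * (1 + x + y + z + m)                          ≡⟨ solve (x ∷ y ∷ z ∷ m ∷ []) ⟩
    2 * (3 + (3 * x + y)) + 6 * m + 2 * (2 * y + 3 * z)
      ≡⟨ cong (2 * (3 + (3 * x + y)) + 6 * m +_) residue ⟩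
    2 * (3 + (3 * x + y)) + 6 * m + (m * n + 2 * (2 * a + 3 * b))
      ≡⟨ solve (x ∷ y ∷ m ∷ n ∷ a ∷ b ∷ []) ⟩
    2 * (3 + (3 * x + y)) + m * (n + 6) + 2 * (2 * a + 3 * b) ∎)

2h≡[2+e]n+2w⇒n≤h : ∀ n {h} e w → 2 * h ≡ (2 + e) * n + 2 * w → n ≤ h
2h≡[2+e]n+2w⇒n≤h n {h} e w eq = *-cancelˡ-≤ 2 (begin
  2 * n                    ≤⟨ m≤m+n _ (e * n + 2 * w) ⟩
  2 * n + (e * n + 2 * w)  ≡⟨ solve (n ∷ e ∷ w ∷ []) ⟩
  (2 + e) * n + 2 * w      ≡⟨ eq ⟨
  2 * h                    ∎)
  where open ≤-Reasoning

2y+3z≢1 : ∀ y z → 2 * y + 3 * z ≢ 1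
2y+3z≢1 y zero    eq = even≢odd y 0 (trans (sym (+-identityʳ (2 * y))) eq)
2y+3z≢1 y (suc z) eq = 0≢1+n (suc-injective (trans (sym eq) (shape y z)))
  where
  shape : ∀ y z → 2 * y + 3 * suc z ≡ 3 + (2 * y + 3 * z)
  shape = solve-∀

S : ℕ → ℕ → Set
S k = ⟨ 6 * k + 7 ∷ 6 * k + 11 ∷ 6 * k + 13 ∷ [] ⟩

suc-x-shift : ∀ n p q x a b → suc x * n + a * p + b * q ≡ n + (x * n + a * p + b * q)
suc-x-shift = solve-∀

3p-relation : ∀ k a b → (3 + a) * (6 * k + 11) + b * (6 * k + 13)
                       ≡ 6 * k + 7 + (a * (6 * k + 11) + (2 + b) * (6 * k + 13))
3p-relation = solve-∀

[2k+3]q-relation : ∀ k a d → a * (6 * k + 11) + (suc (2 * k + 2) + d) * (6 * k + 13)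
  ≡ 6 * k + 7 + ((2 * k + 3) * (6 * k + 7) + suc a * (6 * k + 11) + d * (6 * k + 13))
[2k+3]q-relation = solve-∀

2p+[2k+1]q-relation : ∀ k → 2 * (6 * k + 11) + (2 * k + 1) * (6 * k + 13)
  ≡ 6 * k + 7 + ((2 * k + 4) * (6 * k + 7) + 0 * (6 * k + 11) + 0 * (6 * k + 13))
2p+[2k+1]q-relation = solve-∀

2p+[2k+2]q-relation : ∀ k → 2 * (6 * k + 11) + (2 * k + 2) * (6 * k + 13)
  ≡ 6 * k + 7 + ((2 * k + 4) * (6 * k + 7) + 0 * (6 * k + 11) + 1 * (6 * k + 13))
2p+[2k+2]q-relation = solve-∀

Ap⇒x≡0 : ∀ k x a b →
  Ap (S k) (6 * k + 7) (x * (6 * k + 7) + a * (6 * k + 11) + b * (6 * k + 13)) → x ≡ 0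
Ap⇒x≡0 k zero    a b ap = refl
Ap⇒x≡0 k (suc x) a b ap =
  ⊥-elim (Ap-¬shift (S k) ap (combination∈⟨⟩₃ x a b) (suc-x-shift _ _ _ x a b))

Ap⇒a≤2 : ∀ k a b → Ap (S k) (6 * k + 7) (a * (6 * k + 11) + b * (6 * k + 13)) → a ≤ 2
Ap⇒a≤2 k 0 b ap = z≤n
Ap⇒a≤2 k 1 b ap = s≤s z≤n
Ap⇒a≤2 k 2 b ap = s≤s (s≤s z≤n)
Ap⇒a≤2 k (suc (suc (suc a))) b ap =
  ⊥-elim (Ap-¬shift (S k) ap (combination∈⟨⟩₃ 0 a (2 + b)) (3p-relation k a b))

Ap⇒b≤2k+2 : ∀ k a b → Ap (S k) (6 * k + 7) (a * (6 * k + 11) + b * (6 * k + 13)) →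
            b ≤ 2 * k + 2
Ap⇒b≤2k+2 k a b ap with b ≤? 2 * k + 2
... | yes b≤ = b≤
... | no b≰ with m≤n⇒∃[o]m+o≡n (≰⇒> b≰)
...   | d , refl = ⊥-elim
  (Ap-¬shift (S k) ap (combination∈⟨⟩₃ (2 * k + 3) (suc a) d) ([2k+3]q-relation k a d))

¬Ap[2,2k+1] : ∀ k → ¬ Ap (S k) (6 * k + 7) (2 * (6 * k + 11) + (2 * k + 1) * (6 * k + 13))
¬Ap[2,2k+1] k ap = Ap-¬shift (S k) ap (combination∈⟨⟩₃ (2 * k + 4) 0 0) (2p+[2k+1]q-relation k)

¬Ap[2,2k+2] : ∀ k → ¬ Ap (S k) (6 * k + 7) (2 * (6 * k + 11) + (2 * k + 2) * (6 * k + 13))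
¬Ap[2,2k+2] k ap = Ap-¬shift (S k) ap (combination∈⟨⟩₃ (2 * k + 4) 0 1) (2p+[2k+2]q-relation k)

Ap⇒C : ∀ k a b → Ap (S k) (6 * k + 7) (a * (6 * k + 11) + b * (6 * k + 13)) → C k a b
Ap⇒C k a b ap = (Ap⇒a≤2 k a b ap , Ap⇒b≤2k+2 k a b ap)
              , (λ { (refl , refl) → ¬Ap[2,2k+1] k ap })
              , (λ { (refl , refl) → ¬Ap[2,2k+2] k ap })

C∧n≤2a+3b⇒a≡1×b≡2k+2 : ∀ k {a b} → C k a b → 6 * k + 7 ≤ 2 * a + 3 * b → a ≡ 1 × b ≡ 2 * k + 2
C∧n≤2a+3b⇒a≡1×b≡2k+2 k {a} {b} ((a≤2 , b≤) , ¬[2,2k+1] , ¬[2,2k+2]) n≤h =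
  let (c , b+c≡) = m≤n⇒∃[o]m+o≡n b≤ in top a≤2 b+c≡ (slack b+c≡)
  where
  slack : ∀ {c} → b + c ≡ 2 * k + 2 → 1 + 3 * c ≤ 2 * a
  slack {c} b+c≡ = +-cancelˡ-≤ (6 * k + 6) _ _ (begin
    6 * k + 6 + (1 + 3 * c)  ≡⟨ solve (k ∷ c ∷ []) ⟩
    6 * k + 7 + 3 * c        ≤⟨ +-monoˡ-≤ (3 * c) n≤h ⟩
    2 * a + 3 * b + 3 * c    ≡⟨ solve (a ∷ b ∷ c ∷ []) ⟩
    2 * a + 3 * (b + c)      ≡⟨ cong (λ t → 2 * a + 3 * t) b+c≡ ⟩
    2 * a + 3 * (2 * k + 2)  ≡⟨ solve (a ∷ k ∷ []) ⟩
    6 * k + 6 + 2 * a        ∎)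
    where open ≤-Reasoning
  top : ∀ {c} → a ≤ 2 → b + c ≡ 2 * k + 2 → 1 + 3 * c ≤ 2 * a → a ≡ 1 × b ≡ 2 * k + 2
  top z≤n _ ()
  top {c} (s≤s z≤n) b+c≡ c≤ with *-cancelˡ-< 3 c 1 (≤-trans c≤ (n≤1+n 2))
  ... | s≤s z≤n = refl , trans (sym (+-identityʳ b)) b+c≡
  top {c} (s≤s (s≤s z≤n)) b+c≡ c≤ with *-cancelˡ-≤ {c} {1} 3 (≤-pred c≤)
  ... | z≤n     = ⊥-elim (¬[2,2k+2] (refl , trans (sym (+-identityʳ b)) b+c≡))
  ... | s≤s z≤n = ⊥-elim (¬[2,2k+1]
    (refl , +-cancelʳ-≡ 1 b (2 * k + 1) (trans b+c≡ (sym (+-assoc (2 * k) 1 1)))))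

C-¬residue≥2n : ∀ k {a b} → C k a b → ∀ e w → w ≢ 1 →
  2 * (2 * a + 3 * b) ≢ (2 + e) * (6 * k + 7) + 2 * w
C-¬residue≥2n k c e w w≢1 eq
  with C∧n≤2a+3b⇒a≡1×b≡2k+2 k c (2h≡[2+e]n+2w⇒n≤h (6 * k + 7) e w eq)
... | refl , refl = 2≢en+2w e (+-cancelˡ-≡ (2 * (6 * k + 7)) 2 _ (begin-equality
  2 * (6 * k + 7) + 2                          ≡⟨ solve (k ∷ []) ⟩
  2 * (2 * 1 + 3 * (2 * k + 2))                ≡⟨ eq ⟩
  (2 + e) * (6 * k + 7) + 2 * w                ≡⟨ solve (k ∷ e ∷ w ∷ []) ⟩
  2 * (6 * k + 7) + (e * (6 * k + 7) + 2 * w)  ∎))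
  where
  open ≤-Reasoning
  2≢en+2w : ∀ e → 2 ≢ e * (6 * k + 7) + 2 * w
  2≢en+2w zero    eq₂ = w≢1 (sym (*-cancelˡ-≡ 1 w 2 eq₂))
  2≢en+2w (suc e) eq₂ = 7≰2 (begin
    7                                              ≤⟨ m≤n+m 7 (6 * k) ⟩
    6 * k + 7                                      ≤⟨ m≤m+n _ _ ⟩
    6 * k + 7 + e * (6 * k + 7)                    ≤⟨ m≤m+n _ _ ⟩
    6 * k + 7 + e * (6 * k + 7) + 2 * w            ≡⟨ eq₂ ⟨
    2                                              ∎)
    where
    7≰2 : ¬ 7 ≤ 2
    7≰2 (s≤s (s≤s ()))

even≢[6k+7]+even : ∀ k m o → 2 * m ≢ 1 * (6 * k + 7) + 2 * o
even≢[6k+7]+even k m o eq = even≢odd m (3 * k + 3 + o) (trans eq (solve (k ∷ o ∷ [])))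

C-¬count-residue : ∀ k {a b} → C k a b → ∀ x y z →
  (a + b) * (6 * k + 7) + 2 * (2 * a + 3 * b)
    ≢ (1 + x + y + z) * (6 * k + 7) + 2 * (2 * y + 3 * z)
C-¬count-residue k {a} {b} c@((a≤2 , _) , _) x y z eq with 1 + x + y + z ≤? a + b
... | yes more = <⇒≱ (count≥⇒3≤a (6 * k + 7) a b x y z eq more) a≤2
... | no fewer with m≤n⇒∃[o]m+o≡n (≰⇒> fewer)
...   | m , less with m | cancel-multiples (6 * k + 7) {u = a + b} (trans (+-suc (a + b) m) less) eq
...     | zero  | residue = even≢[6k+7]+even k (2 * a + 3 * b) (2 * y + 3 * z) residue
...     | suc e | residue = C-¬residue≥2n k c e (2 * y + 3 * z) (2y+3z≢1 y z) residue

C-¬shift : ∀ k {a b} → C k a b → ∀ x y z →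
  a * (6 * k + 11) + b * (6 * k + 13)
    ≢ 6 * k + 7 + (x * (6 * k + 7) + y * (6 * k + 11) + z * (6 * k + 13))
C-¬shift k {a} {b} c x y z eq = C-¬count-residue k c x y z (begin
  (a + b) * (6 * k + 7) + 2 * (2 * a + 3 * b)
    ≡⟨ solve (a ∷ b ∷ k ∷ []) ⟩
  a * (6 * k + 11) + b * (6 * k + 13)
    ≡⟨ eq ⟩
  6 * k + 7 + (x * (6 * k + 7) + y * (6 * k + 11) + z * (6 * k + 13))
    ≡⟨ solve (k ∷ x ∷ y ∷ z ∷ []) ⟩
  (1 + x + y + z) * (6 * k + 7) + 2 * (2 * y + 3 * z) ∎)
  where open ≡-Reasoning

theorem14 : (k s : ℕ) →
    Ap ⟨ 6 * k + 7 ∷ 6 * k + 11 ∷ 6 * k + 13 ∷ [] ⟩ (6 * k + 7) s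
      ⇔ (∃ λ a → ∃ λ b → C k a b × s ≡ a * (6 * k + 11) + b * (6 * k + 13))
theorem14 k s = mk⇔ to from
  where
  to : Ap (S k) (6 * k + 7) s → ∃ λ a → ∃ λ b → C k a b × s ≡ a * (6 * k + 11) + b * (6 * k + 13)
  to ap with ⟨⟩₃⇒combination (proj₁ ap)
  ... | x , a , b , refl with Ap⇒x≡0 k x a b ap
  ...   | refl = a , b , Ap⇒C k a b ap , refl
  from : (∃ λ a → ∃ λ b → C k a b × s ≡ a * (6 * k + 11) + b * (6 * k + 13)) → Ap (S k) (6 * k + 7) s
  from (a , b , c , refl) = shift-free⇒Ap {S = S k} (combination∈⟨⟩₃ 0 a b) λ t∈S eq →
    let (x , y , z , t≡) = ⟨⟩₃⇒combination t∈S in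
    C-¬shift k c x y z (trans eq (cong (6 * k + 7 +_) t≡))
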